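{- Let $p$ be a prime and let $\Gamma(D_{2p^2})$ be the intersection graph of $D_{2p^2}$. Then the metric dimension of $\Gamma(D_{2p^2})$ is $\beta(\Gamma(D_{2p^2}))=p^2-p+1$.
   Context: $D_{2n}=\langle r,s : r^n=s^2=1,\ srs=r^{ -1}\rangle$ is the dihedral group of order $2n$. The intersection graph $\Gamma(G)$ of a finite group $G$ has as vertices the proper non-trivial subgroups of $G$, two distinct vertices being adjacent iff their intersection is non-trivial. For an ordered set $W=\{w_1,\dots,w_k\}$ of vertices of a connected graph, the representation of a vertex $v$ is $(d(v,w_1),\dots,d(v,w_k))$; $W$ is a resolving set if distinct vertices have distinct representations. The metric dimension $\beta(\Gamma)$ is the minimum cardinality of a resolving set. -}

module Defs where

open import Data.Nat using (ℕ; zero; suc; _+_; _*_; _∸_; _%_; _<_; NonZero)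
open import Data.Nat.DivMod using (m%n<n)
open import Data.Fin using (Fin; toℕ; fromℕ<)
open import Data.Bool using (Bool; true; false; not)
open import Data.Product using (_×_; _,_; ∃; ∃-syntax; proj₁)
open import Data.List using (List; length)
open import Data.List.Membership.Propositional using (_∈_)
open import Data.List.Relation.Unary.AllPairs using (AllPairs)
open import Relation.Binary.PropositionalEquality using (_≡_; _≢_)
open import Relation.Nullary using (¬_)

-- The dihedral group D_{2n} = ⟨ r, s : rⁿ = s² = 1, srs = r⁻¹ ⟩.
-- The element (k , b) stands for r^k s^b  (k ∈ ℤ/nℤ, b ∈ {0,1}).

module Dihedral (n : ℕ) .{{nz : NonZero n}} where

  Elem : Set
  Elem = Fin n × Bool

  _⊕_ : Fin n → Fin n → Fin n
  a ⊕ c = fromℕ< (m%n<n (toℕ a + toℕ c) n)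

  ⊖_ : Fin n → Fin n
  ⊖ a = fromℕ< (m%n<n (n ∸ toℕ a) n)

  e : Elem
  e = (fromℕ< (m%n<n 0 n) , false)

  -- multiplication:  r^a · r^c s^f = r^(a+c) s^f,
  --                  r^a s · r^c s^f = r^(a-c) s^(1+f)
  _·_ : Elem → Elem → Elem
  (a , false) · (c , f) = (a ⊕ c , f)
  (a , true)  · (c , f) = (a ⊕ (⊖ c) , not f)

  _⁻¹ : Elem → Elem
  (a , false) ⁻¹ = (⊖ a , false)
  (a , true)  ⁻¹ = (a , true)

  record IsSubgroup (H : Elem → Bool) : Set where
    field
      has-e  : H e ≡ true
      mul    : ∀ x y → H x ≡ true → H y ≡ true → H (x · y) ≡ true
      inv    : ∀ x → H x ≡ true → H (x ⁻¹) ≡ true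

  record Vertex : Set where
    field
      carrier    : Elem → Bool
      subgroup   : IsSubgroup carrier
      proper     : ∃[ x ] carrier x ≡ false
      nontrivial : ∃[ x ] (x ≢ e × carrier x ≡ true)
  open Vertex public

  _≈_ : Vertex → Vertex → Set
  H ≈ K = ∀ x → carrier H x ≡ carrier K x

  Adj : Vertex → Vertex → Set
  Adj H K = ¬ (H ≈ K) × ∃[ x ] (x ≢ e × carrier H x ≡ true × carrier K x ≡ true)

  Walk : ℕ → Vertex → Vertex → Set
  Walk zero    H K = H ≈ K
  Walk (suc k) H K = ∃[ L ] (Adj H L × Walk k L K)

  Dist : Vertex → Vertex → ℕ → Set
  Dist H K m = Walk m H K × (∀ k → k < m → ¬ Walk k H K)

  Resolving : List Vertex → Set
  Resolving W = ∀ H K → (∀ w → w ∈ W → ∃[ m ] (Dist H w m × Dist K w m)) → H ≈ K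

  -- W is a set of vertices (no vertex listed twice); its cardinality is its length
  Distinct : List Vertex → Set
  Distinct W = AllPairs (λ H K → ¬ (H ≈ K)) W

  MetricDimension : ℕ → Set
  MetricDimension b =
    (∃[ W ] (Distinct W × Resolving W × length W ≡ b))
    × (∀ W → Distinct W → Resolving W → b Data.Nat.≤ length W)

-- Since p is prime, every proper non-trivial subgroup of D_{2p²} is ⟨r⟩, ⟨rᵖ⟩, ⟨rᵖ, rⁱs⟩ (i < p)
-- or ⟨rᵃs⟩ (a < p²): by Bézout its rotations form ⟨r⟩, ⟨rᵖ⟩ or the trivial group, and its
-- reflections, if any, form a single coset of them.
-- ⟨rᵃs⟩ and ⟨rᵇs⟩ with a ≡ b (mod p) have the same neighbours, and ⟨r⟩, ⟨rᵖ⟩ are adjacent with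
-- the same further neighbours; such twins are equidistant from every other vertex, so a resolving
-- set contains all but at most one member of each of these p + 1 classes, hence at least
-- (p² + 2) − (p + 1) vertices.
-- Conversely ⟨r⟩ together with the ⟨rᵃs⟩, p ≤ a < p², resolves: the distance to ⟨r⟩ separates ⟨r⟩,
-- the subgroups containing rᵖ, and the ⟨rᵃs⟩; among the second kind, ⟨r^{i+p}s⟩ meets only
-- ⟨rᵖ, rⁱs⟩; and for distinct a, b < p the vertex ⟨r^{a+p}s⟩ is at distance 2 from ⟨rᵃs⟩ but not
-- from ⟨rᵇs⟩, because a proper subgroup containing rᵃs and rᵇs with a ≢ b (mod p) would contain r
-- and hence everything.

module Submission where

open import Defs
open import Data.Nat using (ℕ; _+_; _∸_; _^_)
open import Data.Nat.Properties using (m^n≢0)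
open import Data.Nat.Primality using (Prime; prime⇒nonZero)

open import Data.Nat using (zero; suc; _*_; _%_; _/_; _≤_; _<_; NonZero; z≤n; s≤s; z<s; _≟_; nonTrivial⇒n>1; >-nonZero; ≢-nonZero⁻¹)
open import Data.Nat.Properties hiding (m^n≢0)
open import Data.Nat.DivMod
open import Data.Nat.Divisibility using (_∣_; divides; ∣-refl; 1∣_; n∣m⇒m%n≡0)
open import Data.Nat.Coprimality using (prime⇒coprime; coprime-Bézout)
import Data.Nat.Coprimality as Coprime
open import Data.Nat.GCD using (module Bézout)
open import Data.Nat.Induction using (<-wellFounded)
open import Data.Nat.Primality using (prime⇒nonTrivial)
open import Induction.WellFounded using (Acc; acc)
open import Data.Fin as F using (Fin; toℕ; fromℕ<)
open import Data.Fin.Properties as FP using (toℕ-fromℕ<; fromℕ<-cong; toℕ-injective; toℕ<n)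
open import Data.Bool as B using (Bool; true; false; not; _∨_)
open import Data.Bool.Properties using (⇔→≡; ¬-not; not-involutive; ∨-conicalˡ; ∨-conicalʳ)
open import Data.Product using (_×_; _,_; ∃; ∃-syntax; proj₁; proj₂; uncurry)
open import Data.Product.Properties using (≡-dec)
open import Data.Empty using (⊥-elim)
open import Data.List using (List; []; _∷_; length; applyUpTo)
open import Data.List.Properties using (length-applyUpTo)
open import Data.List.Membership.Propositional using (_∈_)
open import Data.List.Membership.Propositional.Properties using (∈-applyUpTo⁺)
open import Data.List.Relation.Unary.Any using (here; there)
open import Data.List.Relation.Unary.AllPairs using (_∷_)
import Data.List.Relation.Unary.All.Properties as All
import Data.List.Relation.Unary.AllPairs.Properties as AllPairs
open import Function using (_∘_)
open import Function.Bundles using (mk⇔)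
open import Relation.Binary.PropositionalEquality
open import Relation.Binary.Definitions using (tri<; tri≈; tri>)
open import Relation.Nullary using (¬_; Dec; yes; no; does; ¬?; _×-dec_)
open import Relation.Nullary.Decidable using (dec-true; dec-false)

dec-sound : ∀ {a} {A : Set a} (a? : Dec A) → does a? ≡ true → A
dec-sound (yes a) _ = a

true≢false : true ≢ false
true≢false ()

least-witness : ∀ {q} {Q : ℕ → Set q} → (∀ k → Dec (Q k)) →
                ∀ {N} → Q N → ∃[ m ] (Q m × (∀ k → k < m → ¬ Q k))
least-witness {Q = Q} Q? = go (<-wellFounded _)
  where
  go : ∀ {N} → Acc _<_ N → Q N → ∃[ m ] (Q m × (∀ k → k < m → ¬ Q k))
  go {N} (acc below) qN with anyUpTo? Q? N
  ... | yes (k , k<N , qk) = go (below k<N) qk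
  ... | no none = N , qN , λ k k<N qk → none (k , k<N , qk)

0%m≡0 : ∀ m .{{_ : NonZero m}} → 0 % m ≡ 0
0%m≡0 (suc _) = refl

infix 4 _≡_modulo_
_≡_modulo_ : ℕ → ℕ → (m : ℕ) → .{{NonZero m}} → Set
_≡_modulo_ a b m = a % m ≡ b % m

infix 5 _≡ᵇ_modulo_
_≡ᵇ_modulo_ : ℕ → ℕ → (m : ℕ) → .{{NonZero m}} → Bool
_≡ᵇ_modulo_ a b m = does (a % m ≟ b % m)

≡-mod-1 : ∀ a b → a ≡ b modulo 1
≡-mod-1 a b = trans (n%1≡0 a) (sym (n%1≡0 b))

module _ {m : ℕ} .{{_ : NonZero m}} where

  ≡ᵇ-sound : ∀ {a b} → a ≡ᵇ b modulo m ≡ true → a ≡ b modulo m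
  ≡ᵇ-sound {a} {b} = dec-sound (a % m ≟ b % m)

  ≡ᵇ-complete : ∀ {a b} → a ≡ b modulo m → a ≡ᵇ b modulo m ≡ true
  ≡ᵇ-complete {a} {b} = dec-true (a % m ≟ b % m)

  ≡ᵇ-false : ∀ {a b} → ¬ a ≡ b modulo m → a ≡ᵇ b modulo m ≡ false
  ≡ᵇ-false {a} {b} = dec-false (a % m ≟ b % m)

  ≡ᵇ-cong : ∀ {a a′ b b′} → a ≡ a′ modulo m → b ≡ b′ modulo m → a ≡ᵇ b modulo m ≡ a′ ≡ᵇ b′ modulo m
  ≡ᵇ-cong a≡a′ b≡b′ = cong₂ (λ x y → does (x ≟ y)) a≡a′ b≡b′

  ≡-modulo⇒≡ : ∀ {a b} → a < m → b < m → a ≡ b modulo m → a ≡ b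
  ≡-modulo⇒≡ a<m b<m a≡b = trans (sym (m<n⇒m%n≡m a<m)) (trans a≡b (m<n⇒m%n≡m b<m))

  %-≡-mod : ∀ a → a % m ≡ a modulo m
  %-≡-mod a = m%n%n≡m%n a m

  +-cong-mod : ∀ {a a′ b b′} → a ≡ a′ modulo m → b ≡ b′ modulo m → a + b ≡ a′ + b′ modulo m
  +-cong-mod {a} {a′} {b} {b′} a≡a′ b≡b′ = begin
    (a + b) % m            ≡⟨ %-distribˡ-+ a b m ⟩
    (a % m + b % m) % m    ≡⟨ cong₂ (λ x y → (x + y) % m) a≡a′ b≡b′ ⟩
    (a′ % m + b′ % m) % m  ≡⟨ %-distribˡ-+ a′ b′ m ⟨
    (a′ + b′) % m          ∎
    where open ≡-Reasoning

  ∸%-inverseʳ : ∀ c → c + (m ∸ c % m) ≡ 0 modulo m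
  ∸%-inverseʳ c = begin
    (c + (m ∸ c % m)) % m      ≡⟨ +-cong-mod {a = c} (sym (%-≡-mod c)) refl ⟩
    (c % m + (m ∸ c % m)) % m  ≡⟨ cong (_% m) (m+[n∸m]≡n (m%n≤n c m)) ⟩
    m % m                      ≡⟨ n%n≡0 m ⟩
    0                          ≡⟨ 0%m≡0 m ⟨
    0 % m                      ∎
    where open ≡-Reasoning

  +-cancelʳ-mod : ∀ a b c → a + c ≡ b + c modulo m → a ≡ b modulo m
  +-cancelʳ-mod a b c a+c≡b+c = begin
    a % m                      ≡⟨ shift a ⟨
    (a + c + (m ∸ c % m)) % m  ≡⟨ +-cong-mod {a = a + c} a+c≡b+c refl ⟩
    (b + c + (m ∸ c % m)) % m  ≡⟨ shift b ⟩
    b % m                      ∎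
    where
    open ≡-Reasoning
    shift : ∀ x → x + c + (m ∸ c % m) ≡ x modulo m
    shift x = begin
      (x + c + (m ∸ c % m)) % m    ≡⟨ cong (_% m) (+-assoc x c _) ⟩
      (x + (c + (m ∸ c % m))) % m  ≡⟨ +-cong-mod {a = x} refl (∸%-inverseʳ c) ⟩
      (x + 0) % m                  ≡⟨ cong (_% m) (+-identityʳ x) ⟩
      x % m                        ∎

  mod-∣ : ∀ {d} .{{_ : NonZero d}} → d ∣ m → ∀ {a b} → a ≡ b modulo m → a ≡ b modulo d
  mod-∣ {d} d∣m {a} {b} a≡b = begin
    a % d      ≡⟨ m∣n⇒o%n%m≡o%m d m a d∣m ⟨
    a % m % d  ≡⟨ cong (_% d) a≡b ⟩
    b % m % d  ≡⟨ m∣n⇒o%n%m≡o%m d m b d∣m ⟩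
    b % d      ∎
    where open ≡-Reasoning

*-distribʳ-linear : ∀ c u v w z k → c + u * v ≡ w * z → c * k + u * (v * k) ≡ w * (z * k)
*-distribʳ-linear c u v w z k eq = begin
  c * k + u * (v * k)  ≡⟨ cong (c * k +_) (*-assoc u v k) ⟨
  c * k + u * v * k    ≡⟨ *-distribʳ-+ k c (u * v) ⟨
  (c + u * v) * k      ≡⟨ cong (_* k) eq ⟩
  w * z * k            ≡⟨ *-assoc w z k ⟩
  w * (z * k)          ∎
  where open ≡-Reasoning

Bézout-*ʳ : ∀ {d a b} k → Bézout.Identity d a b → Bézout.Identity (d * k) (a * k) (b * k)
Bézout-*ʳ {d} {a} {b} k (Bézout.+- x y eq) = Bézout.+- x y (*-distribʳ-linear d y b x a k eq)
Bézout-*ʳ {d} {a} {b} k (Bézout.-+ x y eq) = Bézout.-+ x y (*-distribʳ-linear d x a y b k eq)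

b2n : Bool → ℕ
b2n true = 1
b2n false = 0

count : (ℕ → Bool) → ℕ → ℕ
count f zero = 0
count f (suc N) = b2n (f 0) + count (f ∘ suc) N

count-cong : ∀ N {f g} → (∀ k → k < N → f k ≡ g k) → count f N ≡ count g N
count-cong zero f≗g = refl
count-cong (suc N) f≗g =
  cong₂ _+_ (cong b2n (f≗g 0 (s≤s z≤n))) (count-cong N (λ k k<N → f≗g (suc k) (s≤s k<N)))

count-none : ∀ N {f} → (∀ k → k < N → f k ≡ false) → count f N ≡ 0
count-none zero none = refl
count-none (suc N) none rewrite none 0 (s≤s z≤n) = count-none N (λ k k<N → none (suc k) (s≤s k<N))

count-+ : ∀ a b f → count f (a + b) ≡ count f a + count (λ k → f (a + k)) b
count-+ zero b f = refl
count-+ (suc a) b f = trans (cong (b2n (f 0) +_) (count-+ a b (f ∘ suc))) (sym (+-assoc (b2n (f 0)) _ _))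

count-≤1 : ∀ N f → (∀ j j′ → j < N → j′ < N → f j ≡ true → f j′ ≡ true → j ≡ j′) → count f N ≤ 1
count-≤1 zero f unique = z≤n
count-≤1 (suc N) f unique with f 0 in f0
... | true = ≤-reflexive (cong suc (count-none N rest-false))
  where
  rest-false : ∀ k → k < N → f (suc k) ≡ false
  rest-false k k<N with f (suc k) in fk
  ... | true = ⊥-elim (0≢1+n (unique 0 (suc k) (s≤s z≤n) (s≤s k<N) f0 fk))
  ... | false = refl
... | false = count-≤1 N (f ∘ suc)
  (λ j j′ j<N j′<N fj fj′ → suc-injective (unique (suc j) (suc j′) (s≤s j<N) (s≤s j′<N) fj fj′))

count-∨ : ∀ N f g → count (λ k → f k ∨ g k) N ≤ count f N + count g N
count-∨ zero f g = z≤n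
count-∨ (suc N) f g with f 0 | g 0
... | true | true = s≤s (≤-trans (count-∨ N (f ∘ suc) (g ∘ suc)) (+-monoʳ-≤ (count (f ∘ suc) N) (n≤1+n _)))
... | true | false = s≤s (count-∨ N (f ∘ suc) (g ∘ suc))
... | false | true = ≤-trans (s≤s (count-∨ N (f ∘ suc) (g ∘ suc))) (≤-reflexive (sym (+-suc _ _)))
... | false | false = count-∨ N (f ∘ suc) (g ∘ suc)

count-+-count-not : ∀ N f → count f N + count (not ∘ f) N ≡ N
count-+-count-not zero f = refl
count-+-count-not (suc N) f with f 0
... | true = cong suc (count-+-count-not N (f ∘ suc))
... | false = trans (+-suc _ _) (cong suc (count-+-count-not N (f ∘ suc)))

count-blocks : ∀ m b f → (∀ i → i < m → count (λ k → f (i * b + k)) b ≤ 1) → count f (m * b) ≤ m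
count-blocks zero b f blocks = z≤n
count-blocks (suc m) b f blocks = begin
  count f (b + m * b)                                   ≡⟨ count-+ b (m * b) f ⟩
  count f b + count (λ k → f (b + k)) (m * b)           ≤⟨ +-mono-≤ first rest ⟩
  1 + m                                                 ∎
  where
  open ≤-Reasoning
  first : count f b ≤ 1
  first = blocks 0 z<s
  rest : count (λ k → f (b + k)) (m * b) ≤ m
  rest = count-blocks m b (λ k → f (b + k)) λ i i<m →
    subst (_≤ 1) (count-cong b (λ k _ → cong f (+-assoc b (i * b) k))) (blocks (suc i) (s≤s i<m))

module Transpose (p : ℕ) .{{_ : NonZero p}} where

  %-/-of-+ : ∀ a b → b < p → (a * p + b) % p ≡ b × (a * p + b) / p ≡ a
  %-/-of-+ a b b<p = remainder , quotient
    where
    remainder : (a * p + b) % p ≡ b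
    remainder = trans (cong (_% p) (+-comm (a * p) b)) (trans ([m+kn]%n≡m%n b a p) (m<n⇒m%n≡m b<p))
    quotient : (a * p + b) / p ≡ a
    quotient = begin
      (a * p + b) / p      ≡⟨ +-distrib-/ (a * p) b remainders<p ⟩
      a * p / p + b / p    ≡⟨ cong₂ _+_ (m*n/n≡m a p) (m<n⇒m/n≡0 b<p) ⟩
      a + 0                ≡⟨ +-identityʳ a ⟩
      a                    ∎
      where
      open ≡-Reasoning
      remainders<p : (a * p) % p + b % p < p
      remainders<p = subst (_< p) (sym (cong₂ _+_ (m*n%n≡0 a p) (m<n⇒m%n≡m b<p))) b<p

  transpose : ℕ → ℕ
  transpose j = j % p * p + j / p

  <p*p⇒/<p : ∀ {j} → j < p * p → j / p < p
  <p*p⇒/<p j<p² = m<n*o⇒m/o<n j<p²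

  digits<p*p : ∀ {i k} → i < p → k < p → i * p + k < p * p
  digits<p*p {i} {k} i<p k<p = begin-strict
    i * p + k  <⟨ +-monoʳ-< (i * p) k<p ⟩
    i * p + p  ≡⟨ +-comm (i * p) p ⟩
    suc i * p  ≤⟨ *-monoˡ-≤ p i<p ⟩
    p * p      ∎
    where open ≤-Reasoning

  transpose-digits : ∀ i k → k < p → transpose (i * p + k) ≡ k * p + i
  transpose-digits i k k<p with %-/-of-+ i k k<p
  ... | remainder , quotient = cong₂ (λ x y → x * p + y) remainder quotient

  transpose-< : ∀ {j} → j < p * p → transpose j < p * p
  transpose-< {j} j<p² = digits<p*p (m%n<n j p) (<p*p⇒/<p j<p²)

  transpose-involutive : ∀ {j} → j < p * p → transpose (transpose j) ≡ j
  transpose-involutive {j} j<p² = begin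
    transpose (j % p * p + j / p)  ≡⟨ transpose-digits (j % p) (j / p) (<p*p⇒/<p j<p²) ⟩
    j / p * p + j % p              ≡⟨ +-comm (j / p * p) (j % p) ⟩
    j % p + j / p * p              ≡⟨ m≡m%n+[m/n]*n j p ⟨
    j                              ∎
    where open ≡-Reasoning

  transpose-injective : ∀ {j j′} → j < p * p → j′ < p * p → transpose j ≡ transpose j′ → j ≡ j′
  transpose-injective {j} {j′} j<p² j′<p² eq =
    trans (sym (transpose-involutive j<p²)) (trans (cong transpose eq) (transpose-involutive j′<p²))

module DihedralCalculus (n : ℕ) .{{_ : NonZero n}} where
  open Dihedral n

  neg : ℕ → ℕ
  neg b = n ∸ b % n

  neg-inverseʳ : ∀ b → b + neg b ≡ 0 modulo n
  neg-inverseʳ = ∸%-inverseʳ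

  +-neg-cancelʳ : ∀ a b → a + neg b + b ≡ a modulo n
  +-neg-cancelʳ a b = begin
    (a + neg b + b) % n    ≡⟨ cong (_% n) (+-assoc a (neg b) b) ⟩
    (a + (neg b + b)) % n  ≡⟨ cong (λ x → (a + x) % n) (+-comm (neg b) b) ⟩
    (a + (b + neg b)) % n  ≡⟨ +-cong-mod {a = a} refl (neg-inverseʳ b) ⟩
    (a + 0) % n            ≡⟨ cong (_% n) (+-identityʳ a) ⟩
    a % n                  ∎
    where open ≡-Reasoning

  module _ {q} .{{_ : NonZero q}} (q∣n : q ∣ n) where

    +-neg≡0⇒≡ : ∀ d b → d + neg b ≡ 0 modulo q → d ≡ b modulo q
    +-neg≡0⇒≡ d b d-b≡0 = begin
      d % q                ≡⟨ mod-∣ q∣n (+-neg-cancelʳ d b) ⟨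
      (d + neg b + b) % q  ≡⟨ +-cong-mod {a = d + neg b} {b = b} d-b≡0 refl ⟩
      (0 + b) % q          ∎
      where open ≡-Reasoning

    ≡⇒+-neg≡0 : ∀ d b → d ≡ b modulo q → d + neg b ≡ 0 modulo q
    ≡⇒+-neg≡0 d b d≡b = trans (+-cong-mod {a = d} {b = neg b} d≡b refl) (mod-∣ q∣n (neg-inverseʳ b))

  fin : ℕ → Fin n
  fin c = fromℕ< (m%n<n c n)

  toℕ-fin : ∀ c → toℕ (fin c) ≡ c % n
  toℕ-fin c = toℕ-fromℕ< (m%n<n c n)

  fin-cong : ∀ {c d} → c ≡ d modulo n → fin c ≡ fin d
  fin-cong c≡d = fromℕ<-cong _ _ c≡d _ _

  fin-toℕ : ∀ (i : Fin n) → fin (toℕ i) ≡ i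
  fin-toℕ i = toℕ-injective (trans (toℕ-fin (toℕ i)) (m<n⇒m%n≡m (toℕ<n i)))

  fin-injective : ∀ {c d} → fin c ≡ fin d → c ≡ d modulo n
  fin-injective {c} {d} eq = trans (sym (toℕ-fin c)) (trans (cong toℕ eq) (toℕ-fin d))

  toℕ-injective-mod : ∀ {c d : Fin n} → toℕ c ≡ toℕ d modulo n → c ≡ d
  toℕ-injective-mod {c} {d} c≡d = trans (sym (fin-toℕ c)) (trans (fin-cong c≡d) (fin-toℕ d))

  ≡0⇒≡e : ∀ {c : Fin n} → toℕ c ≡ 0 modulo n → (c , false) ≡ e
  ≡0⇒≡e {c} c≡0 = cong (_, false) (trans (sym (fin-toℕ c)) (fin-cong c≡0))

  fin-injective-< : ∀ {c d} → c < n → d < n → fin c ≡ fin d → c ≡ d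
  fin-injective-< c<n d<n eq = ≡-modulo⇒≡ c<n d<n (fin-injective eq)

  ρ σ : ℕ → Elem
  ρ c = (fin c , false)
  σ c = (fin c , true)

  ⊕-fin : ∀ a b → fin a ⊕ fin b ≡ fin (a + b)
  ⊕-fin a b = fin-cong (begin
    (toℕ (fin a) + toℕ (fin b)) % n  ≡⟨ cong (_% n) (cong₂ _+_ (toℕ-fin a) (toℕ-fin b)) ⟩
    (a % n + b % n) % n              ≡⟨ %-distribˡ-+ a b n ⟨
    (a + b) % n                      ∎)
    where open ≡-Reasoning

  ⊖-fin : ∀ b → ⊖ fin b ≡ fin (neg b)
  ⊖-fin b = cong (λ x → fin (n ∸ x)) (toℕ-fin b)

  ρ-·-ρ : ∀ a b → ρ a · ρ b ≡ ρ (a + b)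
  ρ-·-ρ a b = cong (_, false) (⊕-fin a b)

  ρ-·-σ : ∀ a b → ρ a · σ b ≡ σ (a + b)
  ρ-·-σ a b = cong (_, true) (⊕-fin a b)

  σ-·-σ : ∀ a b → σ a · σ b ≡ ρ (a + neg b)
  σ-·-σ a b = cong (_, false) (trans (cong (fin a ⊕_) (⊖-fin b)) (⊕-fin a (neg b)))

  ρ-⁻¹ : ∀ a → ρ a ⁻¹ ≡ ρ (neg a)
  ρ-⁻¹ a = cong (_, false) (⊖-fin a)

  ρ-toℕ : ∀ c → (c , false) ≡ ρ (toℕ c)
  ρ-toℕ c = cong (_, false) (sym (fin-toℕ c))

  σ-toℕ : ∀ c → (c , true) ≡ σ (toℕ c)
  σ-toℕ c = cong (_, true) (sym (fin-toℕ c))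

  ρ≡e⇒≡0 : ∀ {c} → ρ c ≡ e → c ≡ 0 modulo n
  ρ≡e⇒≡0 {c} eq = fin-injective (cong proj₁ eq)

  module SubgroupsModulo {q} .{{_ : NonZero q}} (q∣n : q ∣ n) where

    toℕ-fin-mod : ∀ c → toℕ (fin c) ≡ c modulo q
    toℕ-fin-mod c = trans (cong (_% q) (toℕ-fin c)) (mod-∣ q∣n (%-≡-mod c))

    toℕ-⊕ : ∀ c d → toℕ (c ⊕ d) ≡ toℕ c + toℕ d modulo q
    toℕ-⊕ c d = trans (cong (_% q) (toℕ-fromℕ< _)) (mod-∣ q∣n (%-≡-mod (toℕ c + toℕ d)))

    toℕ-⊖ : ∀ d → toℕ (⊖ d) + toℕ d ≡ 0 modulo q
    toℕ-⊖ d = begin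
      (toℕ (⊖ d) + toℕ d) % q  ≡⟨ +-cong-mod {a = toℕ (⊖ d)} {b = toℕ d} ⊖d≡n-d refl ⟩
      (n ∸ toℕ d + toℕ d) % q  ≡⟨ cong (_% q) (m∸n+n≡m (<⇒≤ (toℕ<n d))) ⟩
      n % q                    ≡⟨ n∣m⇒m%n≡0 n q q∣n ⟩
      0                        ≡⟨ 0%m≡0 q ⟨
      0 % q                    ∎
      where
      open ≡-Reasoning
      ⊖d≡n-d : toℕ (⊖ d) ≡ n ∸ toℕ d modulo q
      ⊖d≡n-d = trans (cong (_% q) (toℕ-fromℕ< _)) (mod-∣ q∣n (%-≡-mod (n ∸ toℕ d)))

    toℕ-⊕⊖ : ∀ c d → toℕ (c ⊕ (⊖ d)) + toℕ d ≡ toℕ c modulo q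
    toℕ-⊕⊖ c d = begin
      (toℕ (c ⊕ (⊖ d)) + toℕ d) % q      ≡⟨ +-cong-mod {b = toℕ d} (toℕ-⊕ c (⊖ d)) refl ⟩
      (toℕ c + toℕ (⊖ d) + toℕ d) % q    ≡⟨ cong (_% q) (+-assoc (toℕ c) _ _) ⟩
      (toℕ c + (toℕ (⊖ d) + toℕ d)) % q  ≡⟨ +-cong-mod {a = toℕ c} refl (toℕ-⊖ d) ⟩
      (toℕ c + 0) % q                    ≡⟨ cong (_% q) (+-identityʳ (toℕ c)) ⟩
      toℕ c % q                          ∎
      where open ≡-Reasoning

    cyclic : Elem → Bool
    cyclic (c , false) = toℕ c ≡ᵇ 0 modulo q
    cyclic (c , true) = false

    dihedral : ℕ → Elem → Bool
    dihedral i (c , false) = toℕ c ≡ᵇ 0 modulo q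
    dihedral i (c , true) = toℕ c ≡ᵇ i modulo q

    dihedral-cong : ∀ {i j} → i ≡ j modulo q → ∀ x → dihedral i x ≡ dihedral j x
    dihedral-cong i≡j (c , false) = refl
    dihedral-cong i≡j (c , true) = ≡ᵇ-cong refl i≡j

    dihedral-isSubgroup : ∀ i → IsSubgroup (dihedral i)
    dihedral-isSubgroup i = record { has-e = ≡ᵇ-complete (toℕ-fin-mod 0) ; mul = mul ; inv = inv }
      where
      open ≡-Reasoning
      mul : ∀ x y → dihedral i x ≡ true → dihedral i y ≡ true → dihedral i (x · y) ≡ true
      mul (c , false) (d , false) c≡0 d≡0 =
        ≡ᵇ-complete (trans (toℕ-⊕ c d) (+-cong-mod (≡ᵇ-sound c≡0) (≡ᵇ-sound d≡0)))
      mul (c , false) (d , true) c≡0 d≡i =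
        ≡ᵇ-complete (trans (toℕ-⊕ c d) (+-cong-mod (≡ᵇ-sound c≡0) (≡ᵇ-sound d≡i)))
      mul (c , true) (d , false) c≡i d≡0 = ≡ᵇ-complete (+-cancelʳ-mod _ i (toℕ d) (begin
        (toℕ (c ⊕ (⊖ d)) + toℕ d) % q  ≡⟨ toℕ-⊕⊖ c d ⟩
        toℕ c % q                      ≡⟨ ≡ᵇ-sound c≡i ⟩
        i % q                          ≡⟨ cong (_% q) (+-identityʳ i) ⟨
        (i + 0) % q                    ≡⟨ +-cong-mod {a = i} refl (≡ᵇ-sound d≡0) ⟨
        (i + toℕ d) % q                ∎))
      mul (c , true) (d , true) c≡i d≡i = ≡ᵇ-complete (+-cancelʳ-mod _ 0 (toℕ d)
        (trans (toℕ-⊕⊖ c d) (trans (≡ᵇ-sound c≡i) (sym (≡ᵇ-sound d≡i)))))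
      inv : ∀ x → dihedral i x ≡ true → dihedral i (x ⁻¹) ≡ true
      inv (c , false) c≡0 = ≡ᵇ-complete (+-cancelʳ-mod _ 0 (toℕ c) (trans (toℕ-⊖ c) (sym (≡ᵇ-sound c≡0))))
      inv (c , true) c≡i = c≡i

    cyclic-isSubgroup : IsSubgroup cyclic
    cyclic-isSubgroup = record { has-e = IsSubgroup.has-e rotations ; mul = mul ; inv = inv }
      where
      rotations : IsSubgroup (dihedral 0)
      rotations = dihedral-isSubgroup 0
      mul : ∀ x y → cyclic x ≡ true → cyclic y ≡ true → cyclic (x · y) ≡ true
      mul (c , false) (d , false) = IsSubgroup.mul rotations (c , false) (d , false)
      inv : ∀ x → cyclic x ≡ true → cyclic (x ⁻¹) ≡ true
      inv (c , false) = IsSubgroup.inv rotations (c , false)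

    cyclic-ρ : ∀ c → cyclic (ρ c) ≡ c ≡ᵇ 0 modulo q
    cyclic-ρ c = ≡ᵇ-cong (toℕ-fin-mod c) refl

    dihedral-ρ : ∀ i c → dihedral i (ρ c) ≡ c ≡ᵇ 0 modulo q
    dihedral-ρ i c = ≡ᵇ-cong (toℕ-fin-mod c) refl

    dihedral-σ : ∀ i c → dihedral i (σ c) ≡ c ≡ᵇ i modulo q
    dihedral-σ i c = ≡ᵇ-cong (toℕ-fin-mod c) refl

  module SubgroupArithmetic {H : Elem → Bool} (H-sub : IsSubgroup H) where
    open IsSubgroup H-sub

    ρ∈ σ∈ : ℕ → Set
    ρ∈ c = H (ρ c) ≡ true
    σ∈ c = H (σ c) ≡ true

    atρ : ∀ c → H (c , false) ≡ H (ρ (toℕ c))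
    atρ c = cong H (ρ-toℕ c)

    atσ : ∀ c → H (c , true) ≡ H (σ (toℕ c))
    atσ c = cong H (σ-toℕ c)

    ρ∈-mod : ∀ {c d} → c ≡ d modulo n → ρ∈ c → ρ∈ d
    ρ∈-mod c≡d = subst (λ z → H (z , false) ≡ true) (fin-cong c≡d)

    σ∈-mod : ∀ {c d} → c ≡ d modulo n → σ∈ c → σ∈ d
    σ∈-mod c≡d = subst (λ z → H (z , true) ≡ true) (fin-cong c≡d)

    ρ∈-0 : ρ∈ 0
    ρ∈-0 = has-e

    ρ∈-+ : ∀ {a b} → ρ∈ a → ρ∈ b → ρ∈ (a + b)
    ρ∈-+ {a} {b} ha hb = subst (λ z → H z ≡ true) (ρ-·-ρ a b) (mul _ _ ha hb)

    ρ∈-* : ∀ k {a} → ρ∈ a → ρ∈ (k * a)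
    ρ∈-* zero ha = ρ∈-0
    ρ∈-* (suc k) ha = ρ∈-+ ha (ρ∈-* k ha)

    ρ∈-neg : ∀ {a} → ρ∈ a → ρ∈ (neg a)
    ρ∈-neg {a} ha = subst (λ z → H z ≡ true) (ρ-⁻¹ a) (inv _ ha)

    ρ∈-difference : ∀ {a b d} → ρ∈ a → ρ∈ b → b + d ≡ a modulo n → ρ∈ d
    ρ∈-difference {a} {b} {d} ha hb b+d≡a = ρ∈-mod a-b≡d (ρ∈-+ ha (ρ∈-neg hb))
      where
      a-b≡d : a + neg b ≡ d modulo n
      a-b≡d = +-cancelʳ-mod (a + neg b) d b
        (trans (+-neg-cancelʳ a b) (trans (sym b+d≡a) (cong (_% n) (+-comm b d))))

    ρ∈-combination : ∀ {d a b} → Bézout.Identity d a b → ρ∈ a → ρ∈ b → ρ∈ d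
    ρ∈-combination {d} (Bézout.+- x y eq) ha hb =
      ρ∈-difference (ρ∈-* x ha) (ρ∈-* y hb) (cong (_% n) (trans (+-comm (y * _) d) eq))
    ρ∈-combination {d} (Bézout.-+ x y eq) ha hb =
      ρ∈-difference (ρ∈-* y hb) (ρ∈-* x ha) (cong (_% n) (trans (+-comm (x * _) d) eq))

    ρ∈-mul-σ∈ : ∀ {a b} → ρ∈ a → σ∈ b → σ∈ (a + b)
    ρ∈-mul-σ∈ {a} {b} ha hb = subst (λ z → H z ≡ true) (ρ-·-σ a b) (mul _ _ ha hb)

    σ∈-mul-σ∈ : ∀ {a b} → σ∈ a → σ∈ b → ρ∈ (a + neg b)
    σ∈-mul-σ∈ {a} {b} ha hb = subst (λ z → H z ≡ true) (σ-·-σ a b) (mul _ _ ha hb)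

    ρ∈-1⇒ρ∈ : ρ∈ 1 → ∀ c → ρ∈ c
    ρ∈-1⇒ρ∈ h1 c = ρ∈-mod (cong (_% n) (*-identityʳ c)) (ρ∈-* c h1)

    ρ∈-1-σ∈⇒everything : ∀ {b} → ρ∈ 1 → σ∈ b → ∀ x → H x ≡ true
    ρ∈-1-σ∈⇒everything h1 hb (c , false) = trans (atρ c) (ρ∈-1⇒ρ∈ h1 (toℕ c))
    ρ∈-1-σ∈⇒everything {b} h1 hb (c , true) =
      trans (atσ c)
        (σ∈-mod (+-neg-cancelʳ (toℕ c) b) (ρ∈-mul-σ∈ (ρ∈-1⇒ρ∈ h1 (toℕ c + neg b)) hb))

    ρ∈-multiples : ∀ {q} .{{_ : NonZero q}} → ρ∈ q → ∀ {c} → c ≡ 0 modulo q → ρ∈ c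
    ρ∈-multiples {q} hq {c} c≡0 = ρ∈-mod (cong (_% n) (sym c≡c/q*q)) (ρ∈-* (c / q) hq)
      where
      c≡c/q*q : c ≡ c / q * q
      c≡c/q*q = trans (m≡m%n+[m/n]*n c q) (cong (_+ c / q * q) (trans c≡0 (0%m≡0 q)))

    module _ {q} .{{_ : NonZero q}} (q∣n : q ∣ n)
             (ρ∈⇒≡0 : ∀ {c} → ρ∈ c → c ≡ 0 modulo q) (ρ∈-q : ρ∈ q) where
      open SubgroupsModulo q∣n

      ≈-on-rotations : ∀ i c → H (c , false) ≡ dihedral i (c , false)
      ≈-on-rotations i c = ⇔→≡ {z = true} (mk⇔
        (λ h → ≡ᵇ-complete (ρ∈⇒≡0 (trans (sym (atρ c)) h)))
        (λ h → trans (atρ c) (ρ∈-multiples ρ∈-q (≡ᵇ-sound h))))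

      ≈-dihedral : ∀ {b} → σ∈ b → ∀ x → H x ≡ dihedral b x
      ≈-dihedral {b} hb (c , false) = ≈-on-rotations b c
      ≈-dihedral {b} hb (d , true) = ⇔→≡ {z = true} (mk⇔
        (λ h → ≡ᵇ-complete (+-neg≡0⇒≡ q∣n (toℕ d) b (ρ∈⇒≡0 (σ∈-mul-σ∈ (trans (sym (atσ d)) h) hb))))
        (λ h → trans (atσ d) (σ∈-mod (+-neg-cancelʳ (toℕ d) b)
                 (ρ∈-mul-σ∈ (ρ∈-multiples ρ∈-q (≡⇒+-neg≡0 q∣n (toℕ d) b (≡ᵇ-sound h))) hb))))

      ≈-cyclic : (∀ c → H (c , true) ≡ false) → ∀ x → H x ≡ cyclic x
      ≈-cyclic no-σ (c , false) = ≈-on-rotations 0 c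
      ≈-cyclic no-σ (c , true) = no-σ c

module IntersectionGraph (n : ℕ) .{{_ : NonZero n}} where
  open Dihedral n

  ≈-refl : ∀ {H} → H ≈ H
  ≈-refl x = refl

  ≈-sym : ∀ {H K} → H ≈ K → K ≈ H
  ≈-sym H≈K x = sym (H≈K x)

  ≈-trans : ∀ {H K L} → H ≈ K → K ≈ L → H ≈ L
  ≈-trans H≈K K≈L x = trans (H≈K x) (K≈L x)

  Meets : Vertex → Vertex → Set
  Meets H K = ∃[ x ] (x ≢ e × carrier H x ≡ true × carrier K x ≡ true)

  Adj-resp : ∀ {H H′ K K′} → H ≈ H′ → K ≈ K′ → Adj H K → Adj H′ K′
  Adj-resp {H} {H′} {K} {K′} H≈H′ K≈K′ (H≉K , x , x≢e , Hx , Kx) =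
    (λ H′≈K′ → H≉K (≈-trans {H} {H′} {K} H≈H′
                    (≈-trans {H′} {K′} {K} H′≈K′ (≈-sym {K} {K′} K≈K′)))) ,
    x , x≢e , trans (sym (H≈H′ x)) Hx , trans (sym (K≈K′ x)) Kx

  Adj-sym : ∀ {H K} → Adj H K → Adj K H
  Adj-sym {H} {K} (H≉K , x , x≢e , Hx , Kx) = (λ K≈H → H≉K (≈-sym {K} {H} K≈H)) , x , x≢e , Kx , Hx

  Adj⇒Walk₁ : ∀ {H K} → Adj H K → Walk 1 H K
  Adj⇒Walk₁ {H} {K} H~K = K , H~K , ≈-refl {K}

  Walk₁⇒Adj : ∀ {H K} → Walk 1 H K → Adj H K
  Walk₁⇒Adj {H} {K} (L , H~L , L≈K) = Adj-resp {H} {H} {L} {K} (≈-refl {H}) L≈K H~L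

  Walk-respˡ : ∀ k {H H′ K} → H ≈ H′ → Walk k H K → Walk k H′ K
  Walk-respˡ zero {H} {H′} {K} H≈H′ H≈K = ≈-trans {H′} {H} {K} (≈-sym {H} {H′} H≈H′) H≈K
  Walk-respˡ (suc k) {H} {H′} H≈H′ (L , H~L , w) = L , Adj-resp {H} {H′} {L} {L} H≈H′ (≈-refl {L}) H~L , w

  Walk-++ : ∀ a {b H M K} → Walk a H M → Walk b M K → Walk (a + b) H K
  Walk-++ zero {b} {H} {M} {K} H≈M w = Walk-respˡ b {M} {H} {K} (≈-sym {H} {M} H≈M) w
  Walk-++ (suc a) (L , H~L , w₁) w₂ = L , H~L , Walk-++ a w₁ w₂

  Walk-sym : ∀ k {H K} → Walk k H K → Walk k K H
  Walk-sym zero {H} {K} H≈K = ≈-sym {H} {K} H≈K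
  Walk-sym (suc k) {H} {K} (L , H~L , w) =
    subst (λ m → Walk m K H) (+-comm k 1) (Walk-++ k (Walk-sym k w) (Adj⇒Walk₁ {L} {H} (Adj-sym {H} {L} H~L)))

  Dist-respˡ : ∀ {H H′ K m} → H ≈ H′ → Dist H K m → Dist H′ K m
  Dist-respˡ {H} {H′} {K} {m} H≈H′ (w , shortest) =
    Walk-respˡ m {H} {H′} {K} H≈H′ w ,
    λ k k<m w′ → shortest k k<m (Walk-respˡ k {H′} {H} {K} (≈-sym {H} {H′} H≈H′) w′)

  Dist-unique : ∀ {H K m m′} → Dist H K m → Dist H K m′ → m ≡ m′
  Dist-unique {m = m} {m′} (w , shortest) (w′ , shortest′) with <-cmp m m′
  ... | tri< m<m′ _ _ = ⊥-elim (shortest′ m m<m′ w)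
  ... | tri≈ _ m≡m′ _ = m≡m′
  ... | tri> _ _ m′<m = ⊥-elim (shortest m′ m′<m w′)

  _≟ₑ_ : (x y : Elem) → Dec (x ≡ y)
  _≟ₑ_ = ≡-dec F._≟_ B._≟_

  all-Elem? : ∀ {Q : Elem → Set} → (∀ x → Dec (Q x)) → Dec (∀ x → Q x)
  all-Elem? Q? with FP.all? (λ c → Q? (c , false)) | FP.all? (λ c → Q? (c , true))
  ... | yes Qr | yes Qs = yes λ { (c , false) → Qr c ; (c , true) → Qs c }
  ... | no ¬Qr | _ = no λ Q → ¬Qr (λ c → Q (c , false))
  ... | _ | no ¬Qs = no λ Q → ¬Qs (λ c → Q (c , true))

  any-Elem? : ∀ {Q : Elem → Set} → (∀ x → Dec (Q x)) → Dec (∃ Q)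
  any-Elem? Q? with FP.any? (λ c → Q? (c , false)) | FP.any? (λ c → Q? (c , true))
  ... | yes (c , q) | _ = yes ((c , false) , q)
  ... | _ | yes (c , q) = yes ((c , true) , q)
  ... | no ¬Qr | no ¬Qs = no λ { ((c , false) , q) → ¬Qr (c , q) ; ((c , true) , q) → ¬Qs (c , q) }

  _≈?_ : ∀ H K → Dec (H ≈ K)
  H ≈? K = all-Elem? (λ x → carrier H x B.≟ carrier K x)

  Meets? : ∀ H K → Dec (Meets H K)
  Meets? H K = any-Elem? (λ x → ¬? (x ≟ₑ e) ×-dec (carrier H x B.≟ true) ×-dec (carrier K x B.≟ true))

  Adj? : ∀ H K → Dec (Adj H K)
  Adj? H K = ¬? (H ≈? K) ×-dec Meets? H K

  Meets⇒dist≤1 : ∀ {H K m} → Meets H K → Dist H K m → m ≤ 1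
  Meets⇒dist≤1 {H} {K} {m} H∩K (_ , shortest) with m ≤? 1
  ... | yes m≤1 = m≤1
  ... | no m≰1 =
    ⊥-elim (shortest 1 (≰⇒> m≰1) (Adj⇒Walk₁ {H} {K} (shortest 0 (≤-trans z<s (≰⇒> m≰1)) , H∩K)))

  dist≤1⇒Meets : ∀ {H K m} → Dist H K m → m ≤ 1 → Meets H K
  dist≤1⇒Meets {H} {K} {zero} (H≈K , _) _ =
    let (x , x≢e , Kx) = nontrivial K in x , x≢e , trans (H≈K x) Kx , Kx
  dist≤1⇒Meets {H} {K} {suc zero} (w , _) _ = proj₂ (Walk₁⇒Adj {H} {K} w)
  dist≤1⇒Meets {m = suc (suc _)} _ (s≤s ())

  Meets-transfer : ∀ {H H′ K m} → Dist H K m → Dist H′ K m → Meets H K → Meets H′ K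
  Meets-transfer d d′ H∩K = dist≤1⇒Meets d′ (Meets⇒dist≤1 H∩K d)

  module OpenTwins {A B : Vertex} (A~⇒B~ : ∀ L → Adj A L → Adj B L) (B~⇒A~ : ∀ L → Adj B L → Adj A L) where

    walk-swap : ∀ k {X Y K} → (∀ L → Adj X L → Adj Y L) → ¬ X ≈ K → Walk k X K → Walk k Y K
    walk-swap zero _ X≉K X≈K = ⊥-elim (X≉K X≈K)
    walk-swap (suc k) X~⇒Y~ _ (L , X~L , w) = L , X~⇒Y~ L X~L , w

    dist-twin : ∀ {K m} → ¬ A ≈ K → ¬ B ≈ K → Dist A K m → Dist B K m
    dist-twin {m = m} A≉K B≉K (w , shortest) =
      walk-swap m A~⇒B~ A≉K w , λ k k<m w′ → shortest k k<m (walk-swap k B~⇒A~ B≉K w′)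

  module ClosedTwins {A B : Vertex}
                     (A~⇒B~ : ∀ L → ¬ L ≈ B → Adj A L → Adj B L)
                     (B~⇒A~ : ∀ L → ¬ L ≈ A → Adj B L → Adj A L) where

    shortcut : ∀ j {K} → ¬ B ≈ K → Walk j B K → ∃[ i ] (i ≤ j × Walk i A K)
    shortcut zero B≉K B≈K = ⊥-elim (B≉K B≈K)
    shortcut (suc j) {K} _ (L , B~L , w) with L ≈? A
    ... | yes L≈A = j , n≤1+n j , Walk-respˡ j {L} {A} {K} L≈A w
    ... | no L≉A = suc j , ≤-refl , L , B~⇒A~ L L≉A B~L , w

    dist-twin : ∀ {K m} → ¬ A ≈ K → ¬ B ≈ K → Dist A K m → Dist B K m
    dist-twin {K} {zero} A≉K _ (A≈K , _) = ⊥-elim (A≉K A≈K)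
    dist-twin {K} {suc k} _ B≉K ((L , A~L , w) , shortest) = walk , shortestB
      where
      shortestB : ∀ j → j < suc k → ¬ Walk j B K
      shortestB j j<m wj = let (i , i≤j , wi) = shortcut j B≉K wj in shortest i (≤-<-trans i≤j j<m) wi
      walk : Walk (suc k) B K
      walk with L ≈? B
      ... | yes L≈B = ⊥-elim (shortestB k (n<1+n k) (Walk-respˡ k {L} {B} {K} L≈B w))
      ... | no L≉B = L , A~⇒B~ L L≉B A~L , w

  isListed : List Vertex → Vertex → Bool
  isListed [] X = false
  isListed (w ∷ W) X = does (X ≈? w) ∨ isListed W X

  unlisted⇒≉ : ∀ W X → isListed W X ≡ false → ∀ w → w ∈ W → ¬ X ≈ w
  unlisted⇒≉ (w ∷ W) X unlisted .w (here refl) X≈w =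
    true≢false (trans (sym (dec-true (X ≈? w) X≈w)) (∨-conicalˡ _ _ unlisted))
  unlisted⇒≉ (w ∷ W) X unlisted w′ (there w′∈W) = unlisted⇒≉ W X (∨-conicalʳ _ _ unlisted) w′ w′∈W

  count-listed≤length : ∀ W N (Y : ℕ → Vertex) → (∀ j j′ → j < N → j′ < N → Y j ≈ Y j′ → j ≡ j′) →
                        count (λ j → isListed W (Y j)) N ≤ length W
  count-listed≤length [] N Y _ = ≤-reflexive (count-none N (λ _ _ → refl))
  count-listed≤length (w ∷ W) N Y Y-injective =
    ≤-trans (count-∨ N _ _) (+-mono-≤ at-most-one (count-listed≤length W N Y Y-injective))
    where
    at-most-one : count (λ j → does (Y j ≈? w)) N ≤ 1
    at-most-one = count-≤1 N _ λ j j′ j<N j′<N j≈w j′≈w →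
      Y-injective j j′ j<N j′<N
        (≈-trans {Y j} {w} {Y j′} (dec-sound (Y j ≈? w) j≈w) (≈-sym {Y j′} {w} (dec-sound (Y j′ ≈? w) j′≈w)))

  module Distances {I : Set} (vertex : I → Vertex) (cover : ∀ H → ∃[ i ] H ≈ vertex i)
                   (any-I? : ∀ {Q : I → Set} → (∀ i → Dec (Q i)) → Dec (∃ Q)) where

    Walk? : ∀ k H K → Dec (Walk k H K)
    Walk? zero H K = H ≈? K
    Walk? (suc k) H K with any-I? (λ i → Adj? H (vertex i) ×-dec Walk? k (vertex i) K)
    ... | yes (i , H~i , w) = yes (vertex i , H~i , w)
    ... | no none = no λ (L , H~L , w) → let (i , L≈i) = cover L in
      none (i , Adj-resp {H} {H} {L} {vertex i} (≈-refl {H}) L≈i H~L , Walk-respˡ k {L} {vertex i} {K} L≈i w)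

    dist-exists : ∀ {N H K} → Walk N H K → ∃[ m ] Dist H K m
    dist-exists {H = H} {K} = least-witness (λ k → Walk? k H K)

module PrimeSquare (p n : ℕ) {{_ : NonZero p}} {{_ : NonZero n}} (p-prime : Prime p) (n≡p*p : n ≡ p * p) where
  open Dihedral n
  open DihedralCalculus n
  open SubgroupsModulo
  open IntersectionGraph n

  p∣n : p ∣ n
  p∣n = divides p n≡p*p

  1<p : 1 < p
  1<p = nonTrivial⇒n>1 p {{prime⇒nonTrivial p-prime}}

  p<n : p < n
  p<n = subst (p <_) (sym n≡p*p) (subst (_< p * p) (*-identityʳ p) (*-monoʳ-< p 1<p))

  1≢0-mod-p : ¬ 1 ≡ 0 modulo p
  1≢0-mod-p 1≡0 = 1+n≢0 (trans (sym (m<n⇒m%n≡m 1<p)) (trans 1≡0 (0%m≡0 p)))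

  p≢0-mod-n : ¬ p ≡ 0 modulo n
  p≢0-mod-n p≡0 = ≢-nonZero⁻¹ p (trans (sym (m<n⇒m%n≡m p<n)) (trans p≡0 (0%m≡0 n)))

  1≢0-mod-n : ¬ 1 ≡ 0 modulo n
  1≢0-mod-n 1≡0 = 1≢0-mod-p (mod-∣ p∣n 1≡0)

  p≡0-mod-p : p ≡ 0 modulo p
  p≡0-mod-p = trans (n%n≡0 p) (sym (0%m≡0 p))

  ρ≢e : ∀ {c} → ¬ c ≡ 0 modulo n → ρ c ≢ e
  ρ≢e c≢0 ρc≡e = c≢0 (ρ≡e⇒≡0 ρc≡e)

  cyclic-1-ρ : ∀ c → cyclic (1∣ n) (c , false) ≡ true
  cyclic-1-ρ c = ≡ᵇ-complete {m = 1} {a = toℕ c} {b = 0} (≡-mod-1 (toℕ c) 0)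

  Cyc Cycᵖ : Vertex
  Cyc = record
    { carrier = cyclic (1∣ n) ; subgroup = cyclic-isSubgroup (1∣ n) ; proper = σ 0 , refl
    ; nontrivial = ρ 1 , ρ≢e 1≢0-mod-n , cyclic-1-ρ (fin 1) }
  Cycᵖ = record
    { carrier = cyclic p∣n ; subgroup = cyclic-isSubgroup p∣n ; proper = σ 0 , refl
    ; nontrivial = ρ p , ρ≢e p≢0-mod-n , trans (cyclic-ρ p∣n p) (≡ᵇ-complete p≡0-mod-p) }

  Dih : Fin p → Vertex
  Dih i = record
    { carrier = dihedral p∣n (toℕ i) ; subgroup = dihedral-isSubgroup p∣n (toℕ i)
    ; proper = ρ 1 , trans (dihedral-ρ p∣n (toℕ i) 1) (≡ᵇ-false 1≢0-mod-p)
    ; nontrivial = ρ p , ρ≢e p≢0-mod-n , trans (dihedral-ρ p∣n (toℕ i) p) (≡ᵇ-complete p≡0-mod-p) }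

  Ref : Fin n → Vertex
  Ref a = record
    { carrier = dihedral ∣-refl (toℕ a) ; subgroup = dihedral-isSubgroup ∣-refl (toℕ a)
    ; proper = ρ 1 , trans (dihedral-ρ ∣-refl (toℕ a) 1) (≡ᵇ-false 1≢0-mod-n)
    ; nontrivial = (a , true) , (λ ()) , ≡ᵇ-complete {a = toℕ a} refl }

  data Shape : Set where
    cyc cycᵖ : Shape
    dih : Fin p → Shape
    ref : Fin n → Shape

  vertex : Shape → Vertex
  vertex cyc = Cyc
  vertex cycᵖ = Cycᵖ
  vertex (dih i) = Dih i
  vertex (ref a) = Ref a

  residue : ℕ → Fin p
  residue b = fromℕ< (m%n<n b p)

  toℕ-residue : ∀ b → toℕ (residue b) ≡ b modulo p
  toℕ-residue b = trans (cong (_% p) (toℕ-fromℕ< _)) (%-≡-mod b)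

  unit-identity : ∀ {c} → 0 < c → c < p → Bézout.Identity 1 c p
  unit-identity 0<c c<p = coprime-Bézout (Coprime.sym (prime⇒coprime p-prime {{>-nonZero 0<c}} c<p))

  *p≡%p*p : ∀ c → c * p ≡ c % p * p modulo n
  *p≡%p*p c = begin
    (c * p) % n                        ≡⟨ cong (λ x → (x * p) % n) (m≡m%n+[m/n]*n c p) ⟩
    ((c % p + c / p * p) * p) % n      ≡⟨ cong (_% n) (*-distribʳ-+ p (c % p) (c / p * p)) ⟩
    (c % p * p + c / p * p * p) % n    ≡⟨ cong (λ x → (c % p * p + x) % n) (*-assoc (c / p) p p) ⟩
    (c % p * p + c / p * (p * p)) % n  ≡⟨ cong (λ x → (c % p * p + c / p * x) % n) n≡p*p ⟨
    (c % p * p + c / p * n) % n        ≡⟨ [m+kn]%n≡m%n (c % p * p) (c / p) n ⟩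
    (c % p * p) % n                    ∎
    where open ≡-Reasoning

  module Rotations {H : Elem → Bool} (H-sub : IsSubgroup H) where
    open SubgroupArithmetic H-sub

    ρ∈-n : ρ∈ n
    ρ∈-n = ρ∈-mod (trans (0%m≡0 n) (sym (n%n≡0 n))) ρ∈-0

    ρ∈-p-from-multiple : ∀ {c} → 0 < c → c < p → ρ∈ (c * p) → ρ∈ p
    ρ∈-p-from-multiple 0<c c<p h = ρ∈-mod (cong (_% n) (*-identityˡ p))
      (ρ∈-combination (Bézout-*ʳ p (unit-identity 0<c c<p)) h (subst ρ∈ n≡p*p ρ∈-n))

    ρ∈-1-from-unit : ∀ {c} → ρ∈ c → ¬ c ≡ 0 modulo p → ρ∈ 1
    ρ∈-1-from-unit {c} h c≢0 = ρ∈-combination (unit-identity 0<c′ (m%n<n c p)) ρ∈-c′ ρ∈-p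
      where
      0<c′ : 0 < c % p
      0<c′ = n≢0⇒n>0 (λ c′≡0 → c≢0 (trans c′≡0 (sym (0%m≡0 p))))
      ρ∈-p : ρ∈ p
      ρ∈-p = ρ∈-p-from-multiple 0<c′ (m%n<n c p) (ρ∈-mod (*p≡%p*p c) (subst ρ∈ (*-comm p c) (ρ∈-* p h)))
      ρ∈-c′ : ρ∈ (c % p)
      ρ∈-c′ = ρ∈-difference h (ρ∈-* (c / p) ρ∈-p)
        (cong (_% n) (sym (trans (m≡m%n+[m/n]*n c p) (+-comm (c % p) _))))

    ρ∈-p-from-nonzero : ∀ {c} → ρ∈ c → ¬ c ≡ 0 modulo n → ρ∈ p
    ρ∈-p-from-nonzero {c} h c≢0 with c % p ≟ 0 % p
    ... | no c≢0-mod-p = ρ∈-1⇒ρ∈ (ρ∈-1-from-unit h c≢0-mod-p) p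
    ... | yes c≡0-mod-p =
      ρ∈-p-from-multiple 0<c′ c′<p (ρ∈-mod (cong (_% n) c₀≡c′*p) (ρ∈-mod (sym (%-≡-mod c)) h))
      where
      c₀ c′ : ℕ
      c₀ = c % n
      c′ = c₀ / p
      c₀≡c′*p : c₀ ≡ c′ * p
      c₀≡c′*p = trans (m≡m%n+[m/n]*n c₀ p)
        (cong (_+ c′ * p) (trans (mod-∣ p∣n (%-≡-mod c)) (trans c≡0-mod-p (0%m≡0 p))))
      0<c′ : 0 < c′
      0<c′ = n≢0⇒n>0 (λ c′≡0 → c≢0 (trans (trans c₀≡c′*p (cong (_* p) c′≡0)) (sym (0%m≡0 n))))
      c′<p : c′ < p
      c′<p = m<n*o⇒m/o<n (subst (c₀ <_) n≡p*p (m%n<n c n))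

    ρ∈⇒≡0-mod-p : ¬ ρ∈ 1 → ∀ {c} → ρ∈ c → c ≡ 0 modulo p
    ρ∈⇒≡0-mod-p r∉H {c} h with c % p ≟ 0 % p
    ... | yes c≡0 = c≡0
    ... | no c≢0 = ⊥-elim (r∉H (ρ∈-1-from-unit h c≢0))

    ρ∈⇒≡0-mod-n : ¬ ρ∈ p → ∀ {c} → ρ∈ c → c ≡ 0 modulo n
    ρ∈⇒≡0-mod-n rᵖ∉H {c} h with c % n ≟ 0 % n
    ... | yes c≡0 = c≡0
    ... | no c≢0 = ⊥-elim (rᵖ∉H (ρ∈-p-from-nonzero h c≢0))

  module Classification (H : Vertex) where
    open SubgroupArithmetic (subgroup H)
    open Rotations (subgroup H)

    classify-∋r : ρ∈ 1 → H ≈ Cyc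
    classify-∋r r∈H = ≈-cyclic (1∣ n) (λ {c} _ → ≡-mod-1 c 0) r∈H no-reflection
      where
      no-reflection : ∀ c → carrier H (c , true) ≡ false
      no-reflection c = ¬-not λ σc∈H → let (x , x∉H) = proper H in
        true≢false (trans (sym (ρ∈-1-σ∈⇒everything r∈H (trans (sym (atσ c)) σc∈H) x)) x∉H)

    classify-∋rᵖ : ¬ ρ∈ 1 → ρ∈ p → ∃[ S ] H ≈ vertex S
    classify-∋rᵖ r∉H rᵖ∈H with FP.any? (λ b → carrier H (b , true) B.≟ true)
    ... | yes (b , σb∈H) = dih (residue (toℕ b)) , λ x →
      trans (≈-dihedral p∣n (ρ∈⇒≡0-mod-p r∉H) rᵖ∈H (trans (sym (atσ b)) σb∈H) x)
            (dihedral-cong p∣n (sym (toℕ-residue (toℕ b))) x)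
    ... | no none = cycᵖ , ≈-cyclic p∣n (ρ∈⇒≡0-mod-p r∉H) rᵖ∈H (λ c → ¬-not (λ σc∈H → none (c , σc∈H)))

    classify-∌rᵖ : ¬ ρ∈ p → ∃[ S ] H ≈ vertex S
    classify-∌rᵖ rᵖ∉H with nontrivial H
    ... | (c , false) , x≢e , x∈H = ⊥-elim (x≢e (≡0⇒≡e (ρ∈⇒≡0-mod-n rᵖ∉H (trans (sym (atρ c)) x∈H))))
    ... | (a , true) , _ , σa∈H = ref a , ≈-dihedral ∣-refl (ρ∈⇒≡0-mod-n rᵖ∉H) ρ∈-n (trans (sym (atσ a)) σa∈H)

  classify : ∀ H → ∃[ S ] H ≈ vertex S
  classify H with carrier H (ρ 1) in r∈H | carrier H (ρ p) in rᵖ∈H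
  ... | true | _ = cyc , classify-∋r r∈H
    where open Classification H
  ... | false | true = classify-∋rᵖ (λ h → true≢false (trans (sym h) r∈H)) rᵖ∈H
    where open Classification H
  ... | false | false = classify-∌rᵖ (λ h → true≢false (trans (sym h) rᵖ∈H))
    where open Classification H

  Cycᵖ∋ρp : carrier Cycᵖ (ρ p) ≡ true
  Cycᵖ∋ρp = trans (cyclic-ρ p∣n p) (≡ᵇ-complete p≡0-mod-p)

  Dih∋ρp : ∀ i → carrier (Dih i) (ρ p) ≡ true
  Dih∋ρp i = trans (dihedral-ρ p∣n (toℕ i) p) (≡ᵇ-complete p≡0-mod-p)

  Dih∋σ : ∀ i {c} → c ≡ toℕ i modulo p → carrier (Dih i) (σ c) ≡ true
  Dih∋σ i c≡i = trans (dihedral-σ p∣n (toℕ i) _) (≡ᵇ-complete c≡i)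

  Ref∌ρp : ∀ a → carrier (Ref a) (ρ p) ≡ false
  Ref∌ρp a = trans (dihedral-ρ ∣-refl (toℕ a) p) (≡ᵇ-false p≢0-mod-n)

  Ref∋σ : ∀ a → carrier (Ref a) (a , true) ≡ true
  Ref∋σ a = ≡ᵇ-complete {a = toℕ a} refl

  Ref∋σ⇒≡ : ∀ {a b} → carrier (Ref b) (a , true) ≡ true → a ≡ b
  Ref∋σ⇒≡ σa∈Rb = toℕ-injective-mod (≡ᵇ-sound σa∈Rb)

  Ref-nonidentity : ∀ a x → x ≢ e → carrier (Ref a) x ≡ true → x ≡ (a , true)
  Ref-nonidentity a (c , false) x≢e x∈R = ⊥-elim (x≢e (≡0⇒≡e (≡ᵇ-sound x∈R)))
  Ref-nonidentity a (c , true) _ x∈R = cong (_, true) (Ref∋σ⇒≡ x∈R)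

  Meets-Ref⇒∋σ : ∀ X a → Meets X (Ref a) → carrier X (a , true) ≡ true
  Meets-Ref⇒∋σ X a (x , x≢e , x∈X , x∈R) = subst (λ y → carrier X y ≡ true) (Ref-nonidentity a x x≢e x∈R) x∈X

  ∋σ⇒Meets-Ref : ∀ X a → carrier X (a , true) ≡ true → Meets X (Ref a)
  ∋σ⇒Meets-Ref X a σa∈X = (a , true) , (λ ()) , σa∈X , Ref∋σ a

  ¬Meets-Ref-Cyc : ∀ a → ¬ Meets (Ref a) Cyc
  ¬Meets-Ref-Cyc a (x , x≢e , x∈R , x∈C) =
    true≢false (trans (sym x∈C) (cong (carrier Cyc) (Ref-nonidentity a x x≢e x∈R)))

  Meets-Cyc : ∀ {X} → carrier X (ρ p) ≡ true → Meets X Cyc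
  Meets-Cyc ρp∈X = ρ p , ρ≢e p≢0-mod-n , ρp∈X , cyclic-1-ρ (fin p)

  Cyc≉Cycᵖ : ¬ Cyc ≈ Cycᵖ
  Cyc≉Cycᵖ C≈Cᵖ = true≢false (trans (sym (cyclic-1-ρ (fin 1))) (trans (C≈Cᵖ (ρ 1))
    (trans (cyclic-ρ p∣n 1) (≡ᵇ-false 1≢0-mod-p))))

  Cyc≉Ref : ∀ a → ¬ Cyc ≈ Ref a
  Cyc≉Ref a C≈R = true≢false (trans (sym (cyclic-1-ρ (fin 1))) (trans (C≈R (ρ 1))
    (trans (dihedral-ρ ∣-refl (toℕ a) 1) (≡ᵇ-false 1≢0-mod-n))))

  Cycᵖ≉Ref : ∀ a → ¬ Cycᵖ ≈ Ref a
  Cycᵖ≉Ref a Cᵖ≈R = true≢false (trans (sym Cycᵖ∋ρp) (trans (Cᵖ≈R (ρ p)) (Ref∌ρp a)))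

  Dih≉Ref : ∀ i a → ¬ Dih i ≈ Ref a
  Dih≉Ref i a D≈R = true≢false (trans (sym (Dih∋ρp i)) (trans (D≈R (ρ p)) (Ref∌ρp a)))

  Ref-injective : ∀ {a b} → Ref a ≈ Ref b → a ≡ b
  Ref-injective {a} {b} Ra≈Rb = Ref∋σ⇒≡ (trans (sym (Ra≈Rb (a , true))) (Ref∋σ a))

  Cyc~Cycᵖ : Adj Cyc Cycᵖ
  Cyc~Cycᵖ = Cyc≉Cycᵖ , ρ p , ρ≢e p≢0-mod-n , cyclic-1-ρ (fin p) , Cycᵖ∋ρp

  Dih~Cycᵖ : ∀ i → Adj (Dih i) Cycᵖ
  Dih~Cycᵖ i = (λ D≈Cᵖ → true≢false (trans (sym (Dih∋σ i {toℕ i} refl)) (D≈Cᵖ (σ (toℕ i))))) ,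
    ρ p , ρ≢e p≢0-mod-n , Dih∋ρp i , Cycᵖ∋ρp

  Ref~Dih : ∀ a c → c ≡ toℕ a modulo p → Adj (Ref a) (Dih (residue c))
  Ref~Dih a c c≡a = (λ R≈D → Dih≉Ref (residue c) a (≈-sym {Ref a} {Dih (residue c)} R≈D)) ,
    (a , true) , (λ ()) , Ref∋σ a , ≡ᵇ-complete (sym (trans (toℕ-residue c) c≡a))

  toCycᵖ : ∀ S → ∃[ k ] Walk k (vertex S) Cycᵖ
  toCycᵖ cyc = 1 , Adj⇒Walk₁ {Cyc} {Cycᵖ} Cyc~Cycᵖ
  toCycᵖ cycᵖ = 0 , ≈-refl {Cycᵖ}
  toCycᵖ (dih i) = 1 , Adj⇒Walk₁ {Dih i} {Cycᵖ} (Dih~Cycᵖ i)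
  toCycᵖ (ref a) = 2 , Dih (residue (toℕ a)) , Ref~Dih a (toℕ a) refl , Adj⇒Walk₁ {Dih _} {Cycᵖ} (Dih~Cycᵖ _)

  toCycᵖ′ : ∀ H → ∃[ k ] Walk k H Cycᵖ
  toCycᵖ′ H = let (S , H≈S) = classify H ; (k , w) = toCycᵖ S in
    k , Walk-respˡ k {vertex S} {H} {Cycᵖ} (≈-sym {H} {vertex S} H≈S) w

  connected : ∀ H K → ∃[ N ] Walk N H K
  connected H K = let (k , wH) = toCycᵖ′ H ; (l , wK) = toCycᵖ′ K in k + l , Walk-++ k wH (Walk-sym l wK)

  any-Shape? : ∀ {Q : Shape → Set} → (∀ S → Dec (Q S)) → Dec (∃ Q)
  any-Shape? Q? with Q? cyc | Q? cycᵖ | FP.any? (λ i → Q? (dih i)) | FP.any? (λ a → Q? (ref a))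
  ... | yes q | _ | _ | _ = yes (cyc , q)
  ... | _ | yes q | _ | _ = yes (cycᵖ , q)
  ... | _ | _ | yes (i , q) | _ = yes (dih i , q)
  ... | _ | _ | _ | yes (a , q) = yes (ref a , q)
  ... | no ¬c | no ¬cᵖ | no ¬d | no ¬r =
    no λ { (cyc , q) → ¬c q ; (cycᵖ , q) → ¬cᵖ q ; (dih i , q) → ¬d (i , q) ; (ref a , q) → ¬r (a , q) }

  open Distances vertex classify any-Shape?

  distance : ∀ H K → ∃[ m ] Dist H K m
  distance H K = dist-exists (proj₂ (connected H K))

  Ref-twins : ∀ a b → toℕ a ≡ toℕ b modulo p → ∀ L → Adj (Ref a) L → Adj (Ref b) L
  Ref-twins a b a≡b L Ra~L = uncurry twin (classify L)
    where
    σa∈L : carrier L (a , true) ≡ true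
    σa∈L = Meets-Ref⇒∋σ L a (proj₂ (Adj-sym {Ref a} {L} Ra~L))
    σa∈S : ∀ {S} → L ≈ vertex S → carrier (vertex S) (a , true) ≡ true
    σa∈S L≈S = trans (sym (L≈S (a , true))) σa∈L
    twin : ∀ S → L ≈ vertex S → Adj (Ref b) L
    twin cyc L≈S = ⊥-elim (true≢false (sym (σa∈S {cyc} L≈S)))
    twin cycᵖ L≈S = ⊥-elim (true≢false (sym (σa∈S {cycᵖ} L≈S)))
    twin (dih i) L≈S =
      (λ Rb≈L → Dih≉Ref i b (≈-sym {Ref b} {Dih i} (≈-trans {Ref b} {L} {Dih i} Rb≈L L≈S))) ,
      (b , true) , (λ ()) , Ref∋σ b , trans (L≈S (b , true)) (≡ᵇ-complete b≡i)
      where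
      b≡i : toℕ b ≡ toℕ i modulo p
      b≡i = trans (sym a≡b) (≡ᵇ-sound (σa∈S {dih i} L≈S))
    twin (ref c) L≈S = ⊥-elim (proj₁ Ra~L (subst (λ d → Ref d ≈ L) (sym a≡c) (≈-sym {L} {Ref c} L≈S)))
      where
      a≡c : a ≡ c
      a≡c = Ref∋σ⇒≡ (σa∈S {ref c} L≈S)

  Cyc~⇒Cycᵖ~ : ∀ L → ¬ L ≈ Cycᵖ → Adj Cyc L → Adj Cycᵖ L
  Cyc~⇒Cycᵖ~ L L≉Cᵖ (_ , (c , false) , x≢e , _ , x∈L) =
    (λ Cᵖ≈L → L≉Cᵖ (≈-sym {Cycᵖ} {L} Cᵖ≈L)) , ρ p , ρ≢e p≢0-mod-n , Cycᵖ∋ρp , ρp∈L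
    where
    open SubgroupArithmetic (subgroup L)
    open Rotations (subgroup L)
    ρp∈L : ρ∈ p
    ρp∈L = ρ∈-p-from-nonzero (trans (sym (atρ c)) x∈L) (λ c≡0 → x≢e (≡0⇒≡e c≡0))

  Cycᵖ~⇒Cyc~ : ∀ L → ¬ L ≈ Cyc → Adj Cycᵖ L → Adj Cyc L
  Cycᵖ~⇒Cyc~ L L≉C (_ , (c , false) , x≢e , _ , x∈L) =
    (λ C≈L → L≉C (≈-sym {Cyc} {L} C≈L)) , (c , false) , x≢e , cyclic-1-ρ c , x∈L

  unlisted-twins : ∀ W → Resolving W → ∀ {A B} → (∀ {K m} → ¬ A ≈ K → ¬ B ≈ K → Dist A K m → Dist B K m) →
                   isListed W A ≡ false → isListed W B ≡ false → A ≈ B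
  unlisted-twins W resolves {A} {B} dist-twin A∉W B∉W = resolves A B λ w w∈W →
    let (m , d) = distance A w in
    m , d , dist-twin (unlisted⇒≉ W A A∉W w w∈W) (unlisted⇒≉ W B B∉W w w∈W) d

  open Transpose p

  -- Listing the ⟨σ a⟩ in transposed order puts each residue class of a modulo p in a block of p consecutive indices.
  enumeration : ℕ → Vertex
  enumeration 0 = Cyc
  enumeration 1 = Cycᵖ
  enumeration (suc (suc j)) = Ref (fin (transpose j))

  transpose<n : ∀ {j} → j < n → transpose j < n
  transpose<n {j} j<n = subst (transpose j <_) (sym n≡p*p) (transpose-< (subst (j <_) n≡p*p j<n))

  enumeration-injective : ∀ j j′ → j < 2 + n → j′ < 2 + n → enumeration j ≈ enumeration j′ → j ≡ j′
  enumeration-injective 0 0 _ _ _ = refl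
  enumeration-injective 1 1 _ _ _ = refl
  enumeration-injective 0 1 _ _ C≈Cᵖ = ⊥-elim (Cyc≉Cycᵖ C≈Cᵖ)
  enumeration-injective 1 0 _ _ Cᵖ≈C = ⊥-elim (Cyc≉Cycᵖ (≈-sym {Cycᵖ} {Cyc} Cᵖ≈C))
  enumeration-injective 0 (suc (suc j)) _ _ C≈R = ⊥-elim (Cyc≉Ref _ C≈R)
  enumeration-injective (suc (suc j)) 0 _ _ R≈C = ⊥-elim (Cyc≉Ref _ (≈-sym {enumeration (2 + j)} {Cyc} R≈C))
  enumeration-injective 1 (suc (suc j)) _ _ Cᵖ≈R = ⊥-elim (Cycᵖ≉Ref _ Cᵖ≈R)
  enumeration-injective (suc (suc j)) 1 _ _ R≈Cᵖ = ⊥-elim (Cycᵖ≉Ref _ (≈-sym {enumeration (2 + j)} {Cycᵖ} R≈Cᵖ))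
  enumeration-injective (suc (suc j)) (suc (suc j′)) (s≤s (s≤s j<n)) (s≤s (s≤s j′<n)) R≈R =
    cong (suc ∘ suc) (transpose-injective (subst (j <_) n≡p*p j<n) (subst (j′ <_) n≡p*p j′<n)
      (fin-injective-< (transpose<n j<n) (transpose<n j′<n) (Ref-injective R≈R)))

  toℕ-fin-transpose : ∀ i k → k < p → toℕ (fin (transpose (i * p + k))) ≡ i modulo p
  toℕ-fin-transpose i k k<p = begin
    toℕ (fin (transpose (i * p + k))) % p  ≡⟨ toℕ-fin-mod p∣n _ ⟩
    transpose (i * p + k) % p              ≡⟨ cong (_% p) (trans (transpose-digits i k k<p) (+-comm (k * p) i)) ⟩
    (i + k * p) % p                        ≡⟨ [m+kn]%n≡m%n i k p ⟩
    i % p                                  ∎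
    where open ≡-Reasoning

  lower-bound : ∀ W → Resolving W → n ∸ p + 1 ≤ length W
  lower-bound W resolves = arithmetic (begin
    2 + n                                          ≡⟨ count-+-count-not (2 + n) listed ⟨
    count listed (2 + n) + count unlisted (2 + n)  ≤⟨ +-mono-≤ listed≤length unlisted≤1+p ⟩
    length W + (1 + p)                             ∎)
    where
    open ≤-Reasoning
    listed unlisted : ℕ → Bool
    listed j = isListed W (enumeration j)
    unlisted j = not (listed j)

    listed≤length : count listed (2 + n) ≤ length W
    listed≤length = count-listed≤length W (2 + n) enumeration enumeration-injective

    not≡true : ∀ {b} → not b ≡ true → b ≡ false
    not≡true {b} h = trans (sym (not-involutive b)) (cong not h)

    one-of-Cyc-Cycᵖ : b2n (unlisted 0) + b2n (unlisted 1) ≤ 1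
    one-of-Cyc-Cycᵖ with isListed W Cyc in C∈W | isListed W Cycᵖ in Cᵖ∈W
    ... | true | true = z≤n
    ... | true | false = ≤-refl
    ... | false | true = ≤-refl
    ... | false | false = ⊥-elim (Cyc≉Cycᵖ
      (unlisted-twins W resolves {Cyc} {Cycᵖ} (ClosedTwins.dist-twin Cyc~⇒Cycᵖ~ Cycᵖ~⇒Cyc~) C∈W Cᵖ∈W))

    one-per-class : ∀ i → i < p → count (λ k → unlisted (2 + (i * p + k))) p ≤ 1
    one-per-class i i<p = count-≤1 p _ λ k k′ k<p k′<p k∉W k′∉W →
      +-cancelˡ-≡ (i * p) k k′ (transpose-injective (digits<p*p i<p k<p) (digits<p*p i<p k′<p)
        (fin-injective-< (transpose<n (ipk<n k<p)) (transpose<n (ipk<n k′<p))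
          (Ref-injective (unlisted-twins W resolves
            (OpenTwins.dist-twin (Ref-twins _ _ (same-class k<p k′<p)) (Ref-twins _ _ (same-class k′<p k<p)))
            (not≡true k∉W) (not≡true k′∉W)))))
      where
      ipk<n : ∀ {k} → k < p → i * p + k < n
      ipk<n k<p = subst (_ <_) (sym n≡p*p) (digits<p*p i<p k<p)
      same-class : ∀ {k k′} → k < p → k′ < p →
                   toℕ (fin (transpose (i * p + k))) ≡ toℕ (fin (transpose (i * p + k′))) modulo p
      same-class {k} {k′} k<p k′<p = trans (toℕ-fin-transpose i k k<p) (sym (toℕ-fin-transpose i k′ k′<p))

    unlisted≤1+p : count unlisted (2 + n) ≤ 1 + p
    unlisted≤1+p = begin
      count unlisted (2 + n)                                                ≡⟨ +-assoc (b2n (unlisted 0)) _ _ ⟨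
      b2n (unlisted 0) + b2n (unlisted 1) + count (unlisted ∘ suc ∘ suc) n  ≤⟨ +-mono-≤ one-of-Cyc-Cycᵖ refs≤p ⟩
      1 + p                                                                 ∎
      where
      refs≤p : count (unlisted ∘ suc ∘ suc) n ≤ p
      refs≤p = subst (λ m → count (unlisted ∘ suc ∘ suc) m ≤ p) (sym n≡p*p)
        (count-blocks p p (unlisted ∘ suc ∘ suc) one-per-class)

    arithmetic : 2 + n ≤ length W + (1 + p) → n ∸ p + 1 ≤ length W
    arithmetic h = subst (_≤ length W) (+-∸-comm 1 (<⇒≤ p<n))
      (m≤n+o⇒m∸n≤o (n + 1) p (subst (n + 1 ≤_) (+-comm (length W) p)
        (≤-pred (subst₂ _≤_ (cong suc (+-comm 1 n)) (+-suc (length W) p) h))))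

  lifted : ℕ → Vertex
  lifted c = Ref (fin (c + p))

  W₀ : List Vertex
  W₀ = Cyc ∷ applyUpTo lifted (n ∸ p)

  W₀-length : length W₀ ≡ n ∸ p + 1
  W₀-length = trans (cong suc (length-applyUpTo lifted (n ∸ p))) (+-comm 1 (n ∸ p))

  W₀-distinct : Distinct W₀
  W₀-distinct = All.applyUpTo⁺₂ lifted (n ∸ p) (λ _ → Cyc≉Ref _) ∷
                AllPairs.applyUpTo⁺₁ lifted (n ∸ p) distinct
    where
    <n : ∀ {i} → i < n ∸ p → i + p < n
    <n {i} i<n-p = subst (i + p <_) (m∸n+n≡m (<⇒≤ p<n)) (+-monoˡ-< p i<n-p)
    distinct : ∀ {i j} → i < j → j < n ∸ p → ¬ lifted i ≈ lifted j
    distinct {i} {j} i<j j<n-p Ri≈Rj = <-irrefl (+-cancelʳ-≡ p i j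
      (fin-injective-< (<n (<-trans i<j j<n-p)) (<n j<n-p) (Ref-injective Ri≈Rj))) i<j

  lifted∈W₀ : ∀ {c} → c < n ∸ p → lifted c ∈ W₀
  lifted∈W₀ c<n-p = there (∈-applyUpTo⁺ lifted c<n-p)

  lifted-small∈W₀ : ∀ {c} → c < p → lifted c ∈ W₀
  lifted-small∈W₀ {c} c<p = lifted∈W₀ (m+n≤o⇒m≤o∸n (suc c) (begin
    suc c + p  ≤⟨ +-monoˡ-≤ p c<p ⟩
    p + p      ≡⟨ cong (p +_) (+-identityʳ p) ⟨
    2 * p      ≤⟨ *-monoˡ-≤ p 1<p ⟩
    p * p      ≡⟨ n≡p*p ⟨
    n          ∎))
    where open ≤-Reasoning

  Ref∈W₀ : ∀ a → p ≤ toℕ a → Ref a ∈ W₀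
  Ref∈W₀ a p≤a = subst (_∈ W₀) (cong Ref (trans (cong fin (m∸n+n≡m p≤a)) (fin-toℕ a)))
    (lifted∈W₀ (∸-monoˡ-< (toℕ<n a) p≤a))

  toℕ-lifted : ∀ c → toℕ (fin (c + p)) ≡ c modulo p
  toℕ-lifted c = trans (toℕ-fin-mod p∣n (c + p)) ([m+n]%n≡m%n c p)

  reflections-congruent : ∀ L {b c} → carrier L (b , true) ≡ true → carrier L (c , true) ≡ true →
                          toℕ b ≡ toℕ c modulo p
  reflections-congruent L {b} {c} σb∈L σc∈L with (toℕ b + neg (toℕ c)) % p ≟ 0 % p
  ... | yes b-c≡0 = +-neg≡0⇒≡ p∣n (toℕ b) (toℕ c) b-c≡0
  ... | no b-c≢0 = let (x , x∉L) = proper L in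
    ⊥-elim (true≢false (trans (sym (ρ∈-1-σ∈⇒everything r∈L σb∈L′ x)) x∉L))
    where
    open SubgroupArithmetic (subgroup L)
    open Rotations (subgroup L)
    σb∈L′ : σ∈ (toℕ b)
    σb∈L′ = trans (sym (atσ b)) σb∈L
    r∈L : ρ∈ 1
    r∈L = ρ∈-1-from-unit (σ∈-mul-σ∈ σb∈L′ (trans (sym (atσ c)) σc∈L)) b-c≢0

  no-short-walk : ∀ {b c} m → m ≤ 2 → ¬ toℕ b ≡ toℕ c modulo p → ¬ Walk m (Ref b) (Ref c)
  no-short-walk {b} {c} 0 _ b≢c Rb≈Rc =
    b≢c (reflections-congruent (Ref c) (trans (sym (Rb≈Rc (b , true))) (Ref∋σ b)) (Ref∋σ c))
  no-short-walk {b} {c} 1 _ b≢c w =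
    b≢c (reflections-congruent (Ref b) (Ref∋σ b) (Meets-Ref⇒∋σ (Ref b) c (proj₂ (Walk₁⇒Adj {Ref b} {Ref c} w))))
  no-short-walk {b} {c} 2 _ b≢c (L , Rb~L , L′ , L~L′ , L′≈Rc) =
    b≢c (reflections-congruent L (Meets-Ref⇒∋σ L b (proj₂ (Adj-sym {Ref b} {L} Rb~L)))
      (Meets-Ref⇒∋σ L c (proj₂ (Adj-resp {L} {L} {L′} {Ref c} (≈-refl {L}) L′≈Rc L~L′))))
  no-short-walk (suc (suc (suc _))) (s≤s (s≤s ())) _

  walk-to-lifted : ∀ a → Walk 2 (Ref a) (lifted (toℕ a))
  walk-to-lifted a = Dih (residue (toℕ a)) , Ref~Dih a (toℕ a) refl ,
    Adj⇒Walk₁ {Dih _} {lifted (toℕ a)} (Adj-sym {lifted (toℕ a)} {Dih _} (Ref~Dih _ (toℕ a) (sym (toℕ-lifted (toℕ a)))))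

  Dih∋σ-lifted : ∀ i → carrier (Dih i) (fin (toℕ i + p) , true) ≡ true
  Dih∋σ-lifted i = Dih∋σ i ([m+n]%n≡m%n (toℕ i) p)

  Agree : Shape → Shape → Set
  Agree S T = ∀ w → w ∈ W₀ → ∃[ m ] (Dist (vertex S) w m × Dist (vertex T) w m)

  Agree-sym : ∀ {S T} → Agree S T → Agree T S
  Agree-sym agree w w∈W₀ = let (m , dS , dT) = agree w w∈W₀ in m , dT , dS

  Agree-meets : ∀ {S T} → Agree S T → ∀ {w} → w ∈ W₀ → Meets (vertex S) w → Meets (vertex T) w
  Agree-meets {S} {T} agree {w} w∈W₀ =
    let (m , dS , dT) = agree w w∈W₀ in Meets-transfer {vertex S} {vertex T} {w} dS dT

  Agree-dih : ∀ {i T} → Agree (dih i) T → carrier (vertex T) (fin (toℕ i + p) , true) ≡ true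
  Agree-dih {i} {T} agree = Meets-Ref⇒∋σ (vertex T) _
    (Agree-meets {dih i} {T} agree (lifted-small∈W₀ (toℕ<n i)) (∋σ⇒Meets-Ref (Dih i) _ (Dih∋σ-lifted i)))

  Agree-cyc : ∀ {T} → Agree cyc T → Cyc ≈ vertex T
  Agree-cyc {T} agree with agree Cyc (here refl)
  ... | m , dC , dT with Dist-unique {Cyc} {Cyc} dC (≈-refl {Cyc} , λ _ ())
  ... | refl = ≈-sym {vertex T} {Cyc} (proj₁ dT)

  ¬Agree-ref : ∀ {S a} → Meets (vertex S) Cyc → ¬ Agree S (ref a)
  ¬Agree-ref {S} {a} S∩C agree = ¬Meets-Ref-Cyc a (Agree-meets {S} {ref a} agree (here refl) S∩C)

  Agree-ref-small : ∀ {a b} → Agree (ref a) (ref b) → toℕ a < p → toℕ b ≡ toℕ a modulo p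
  Agree-ref-small {a} {b} agree a<p with toℕ b % p ≟ toℕ a % p
  ... | yes b≡a = b≡a
  ... | no b≢a with agree (lifted (toℕ a)) (lifted-small∈W₀ a<p)
  ... | m , (_ , shortestA) , (walkB , _) =
    ⊥-elim (no-short-walk m m≤2 (λ b≡a+p → b≢a (trans b≡a+p (toℕ-lifted (toℕ a)))) walkB)
    where
    m≤2 : m ≤ 2
    m≤2 = ≮⇒≥ (λ 2<m → shortestA 2 2<m (walk-to-lifted a))

  Agree-ref : ∀ {a b} → Agree (ref a) (ref b) → a ≡ b
  Agree-ref {a} {b} agree with p ≤? toℕ a | p ≤? toℕ b
  ... | yes p≤a | _ = Ref∋σ⇒≡ (Meets-Ref⇒∋σ (Ref b) a
    (Agree-meets {ref a} {ref b} agree (Ref∈W₀ a p≤a) (∋σ⇒Meets-Ref (Ref a) a (Ref∋σ a))))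
  ... | _ | yes p≤b = sym (Ref∋σ⇒≡ (Meets-Ref⇒∋σ (Ref a) b
    (Agree-meets {ref b} {ref a} (Agree-sym {ref a} {ref b} agree) (Ref∈W₀ b p≤b) (∋σ⇒Meets-Ref (Ref b) b (Ref∋σ b)))))
  ... | no p≰a | no p≰b = toℕ-injective (≡-modulo⇒≡ (≰⇒> p≰a) (≰⇒> p≰b) (sym (Agree-ref-small agree (≰⇒> p≰a))))

  resolve : ∀ S T → Agree S T → vertex S ≈ vertex T
  resolve cyc T agree = Agree-cyc {T} agree
  resolve S cyc agree = ≈-sym {Cyc} {vertex S} (Agree-cyc {S} (Agree-sym {S} {cyc} agree))
  resolve cycᵖ cycᵖ _ = ≈-refl {Cycᵖ}
  resolve cycᵖ (dih j) agree = ⊥-elim (true≢false (sym (Agree-dih {j} {cycᵖ} (Agree-sym {cycᵖ} {dih j} agree))))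
  resolve (dih i) cycᵖ agree = ⊥-elim (true≢false (sym (Agree-dih {i} {cycᵖ} agree)))
  resolve (dih i) (dih j) agree = subst (λ k → Dih i ≈ Dih k) i≡j (≈-refl {Dih i})
    where
    i≡j : i ≡ j
    i≡j = toℕ-injective (≡-modulo⇒≡ (toℕ<n i) (toℕ<n j)
      (trans (sym (toℕ-lifted (toℕ i))) (≡ᵇ-sound (Agree-dih {i} {dih j} agree))))
  resolve cycᵖ (ref b) agree = ⊥-elim (¬Agree-ref {cycᵖ} (Meets-Cyc {Cycᵖ} Cycᵖ∋ρp) agree)
  resolve (dih i) (ref b) agree = ⊥-elim (¬Agree-ref {dih i} (Meets-Cyc {Dih i} (Dih∋ρp i)) agree)
  resolve (ref a) cycᵖ agree =
    ⊥-elim (¬Agree-ref {cycᵖ} (Meets-Cyc {Cycᵖ} Cycᵖ∋ρp) (Agree-sym {ref a} {cycᵖ} agree))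
  resolve (ref a) (dih j) agree =
    ⊥-elim (¬Agree-ref {dih j} (Meets-Cyc {Dih j} (Dih∋ρp j)) (Agree-sym {ref a} {dih j} agree))
  resolve (ref a) (ref b) agree = subst (λ c → Ref a ≈ Ref c) (Agree-ref agree) (≈-refl {Ref a})

  W₀-resolving : Resolving W₀
  W₀-resolving H K agree with classify H | classify K
  ... | S , H≈S | T , K≈T = ≈-trans {H} {vertex S} {K} H≈S
    (≈-trans {vertex S} {vertex T} {K} (resolve S T agree′) (≈-sym {K} {vertex T} K≈T))
    where
    agree′ : Agree S T
    agree′ w w∈W₀ = let (m , dH , dK) = agree w w∈W₀ in
      m , Dist-respˡ {H} {vertex S} {w} {m} H≈S dH , Dist-respˡ {K} {vertex T} {w} {m} K≈T dK

  metric-dimension : MetricDimension (n ∸ p + 1)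
  metric-dimension = (W₀ , W₀-distinct , W₀-resolving , W₀-length) , λ W _ → lower-bound W

theorem4p3 : (p : ℕ) (pp : Prime p) →
    Dihedral.MetricDimension (p ^ 2) {{m^n≢0 p 2 {{prime⇒nonZero pp}}}} (p ^ 2 ∸ p + 1)
theorem4p3 p pp = PrimeSquare.metric-dimension p (p ^ 2) {{prime⇒nonZero pp}} {{m^n≢0 p 2 {{prime⇒nonZero pp}}}}
  pp (cong (p *_) (*-identityʳ p))
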